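{- Let $\mathcal{G}=(V,E)$ be a non-bipartite graph and $I\subseteq V$ an independent set such that $\mathcal{G}\setminus I$ is bipartite. Let $2\rho-1$ be the odd girth of the contracted graph $\mathcal{G}/I$. Then for every $w\in Q^W$, \[R(w):=\frac{w(I)+w(OPT(\mathcal{G}\setminus I))}{w(OPT(\mathcal{G}))}\le 1+\frac1\rho.\]
   Context: $\mathcal{G}\setminus I$ is obtained by deleting $I$ and all incident edges. $\mathcal{G}/I$ is the (multi)graph obtained by contracting all vertices of $I$ into a single new vertex $v^I$: each edge $(u,x)$ with $u\notin I$, $x\in I$ becomes an edge $(u,v^I)$, parallel edges are kept, no self-loops are created. The odd girth is the length of a shortest odd cycle. $Q^W$ is the set of $w\in\mathbb{R}_+^V$ with $w(V)=2$ for which some $y\in\mathbb{R}_+^E$ satisfies $y(\delta(v))=w_v$ for all $v$ ($\delta(v)$ = edges incident to $v$). A vertex cover contains at least one endpoint of every edge; $OPT(\mathcal{H})$ is a minimum $w$-weight vertex cover of $\mathcal{H}$; $w(X)=\sum_{v\in X}w_v$.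
   Formalization: The vertex weights and the edge values y take values in the nonnegative rationals rather than in $\mathbb{R}_+^V$ and $\mathbb{R}_+^E$. -}

module Defs where

open import Data.Nat using (ℕ; zero; suc; _≤_; _*_; _∸_)
open import Data.Fin using (Fin; zero; suc)
open import Data.Bool using (Bool; true; false; if_then_else_)
open import Data.Maybe using (Maybe; just; nothing)
open import Data.Product using (Σ; ∃; _×_; _,_)
open import Data.Sum using (_⊎_)
open import Data.Unit using (⊤)
open import Data.Empty using (⊥)
open import Relation.Nullary using (¬_)
open import Relation.Binary.PropositionalEquality using (_≡_; _≢_)
open import Function.Definitions using (Injective)
open import Data.Rational as ℚ using (ℚ; 0ℚ)

record Graph : Set where
  field
    n     : ℕ
    adj   : Fin n → Fin n → Bool
    sym   : ∀ u v → adj u v ≡ adj v u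
    irrfl : ∀ v → adj v v ≡ false
open Graph public

Fin' : Graph → Set
Fin' G = Fin (n G)

VSet : Graph → Set
VSet G = Fin (n G) → Bool

Σℚ : ∀ {m} → (Fin m → ℚ) → ℚ
Σℚ {zero}  f = 0ℚ
Σℚ {suc m} f = f zero ℚ.+ Σℚ (λ i → f (suc i))

wt : ∀ {m} → (Fin m → ℚ) → (Fin m → Bool) → ℚ
wt w X = Σℚ (λ v → if X v then w v else 0ℚ)

Bipartite : Graph → Set
Bipartite G = Σ (Fin (n G) → Bool) λ f →
  ∀ u v → adj G u v ≡ true → f u ≢ f v

Independent : (G : Graph) → VSet G → Set
Independent G I = ∀ u v → I u ≡ true → I v ≡ true → adj G u v ≡ false

BipartiteMinus : (G : Graph) → VSet G → Set
BipartiteMinus G I = Σ (Fin (n G) → Bool) λ f →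
  ∀ u v → I u ≡ false → I v ≡ false → adj G u v ≡ true → f u ≢ f v

-- Contracted graph G / I.  Vertices: `nothing` is the new vertex v^I,
-- `just v` with v ∉ I are the remaining vertices.
CVertex : (G : Graph) → VSet G → Maybe (Fin (n G)) → Set
CVertex G I nothing  = ⊤
CVertex G I (just v) = I v ≡ false

-- Adjacency in G / I (parallel edges do not matter for cycles of length ≥ 3;
-- there are no self-loops).
CAdj : (G : Graph) → VSet G → Maybe (Fin (n G)) → Maybe (Fin (n G)) → Set
CAdj G I (just u) (just v) = adj G u v ≡ true
CAdj G I (just u) nothing  = ∃ λ x → I x ≡ true × adj G u x ≡ true
CAdj G I nothing  (just v) = ∃ λ x → I x ≡ true × adj G x v ≡ true
CAdj G I nothing  nothing  = ⊥

next : ∀ {k} → Fin k → Fin k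
next {suc k} i with Data.Fin.toℕ i Data.Nat.≟ k
... | Relation.Nullary.yes _ = zero
... | Relation.Nullary.no ne = Data.Fin.fromℕ< {suc (Data.Fin.toℕ i)} {suc k}
        (Data.Nat.s≤s (Data.Nat.Properties.≤∧≢⇒< (Data.Fin.Properties.toℕ≤pred[n] i) ne))
  where import Data.Fin.Properties; import Data.Nat.Properties

CCycle : (G : Graph) → VSet G → ℕ → Set
CCycle G I k = 3 ≤ k × Σ (Fin k → Maybe (Fin (n G))) λ c →
  Injective _≡_ _≡_ c × (∀ i → CVertex G I (c i)) × (∀ i → CAdj G I (c i) (c (next i)))

Odd : ℕ → Set
Odd k = ∃ λ m → k ≡ suc (2 * m)

OddGirthContr : (G : Graph) → VSet G → ℕ → Set
OddGirthContr G I g = (Odd g × CCycle G I g) × (∀ k → Odd k → CCycle G I k → g ≤ k)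

InQW : (G : Graph) → (Fin (n G) → ℚ) → Set
InQW G w = (∀ v → 0ℚ ℚ.≤ w v) × Σℚ w ≡ ℚ.1ℚ ℚ.+ ℚ.1ℚ ×
  Σ (Fin (n G) → Fin (n G) → ℚ) λ y →
    (∀ u v → 0ℚ ℚ.≤ y u v) × (∀ u v → y u v ≡ y v u) ×
    (∀ u v → adj G u v ≡ false → y u v ≡ 0ℚ) × (∀ v → Σℚ (y v) ≡ w v)

VertexCover : (G : Graph) → VSet G → Set
VertexCover G C = ∀ u v → adj G u v ≡ true → C u ≡ true ⊎ C v ≡ true

VertexCoverMinus : (G : Graph) → VSet G → VSet G → Set
VertexCoverMinus G I C = (∀ v → C v ≡ true → I v ≡ false) ×
  (∀ u v → I u ≡ false → I v ≡ false → adj G u v ≡ true → C u ≡ true ⊎ C v ≡ true)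

IsOPT : (G : Graph) → (Fin (n G) → ℚ) → VSet G → Set
IsOPT G w C = VertexCover G C × (∀ D → VertexCover G D → wt w C ℚ.≤ wt w D)

IsOPTMinus : (G : Graph) → VSet G → (Fin (n G) → ℚ) → VSet G → Set
IsOPTMinus G I w C = VertexCoverMinus G I C ×
  (∀ D → VertexCoverMinus G I D → wt w C ℚ.≤ wt w D)

module Submission where

-- Let colour 2-colour G ∖ I and let dist b v be the distance in G ∖ I from v to the vertices
-- of colour b adjacent to I. Descending from a vertex x to both of these source sets and
-- closing up through the contracted vertex v^I gives a closed walk of length
-- dist true x + dist false x + 2, which is odd since its two ends in G ∖ I have different
-- colours. For x minimising dist true x + dist false x the walk is a cycle of G / I, so the
-- odd girth gives 2ρ ≤ 3 + dist true x + dist false x for every x.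
--
-- Fix a vertex cover C of G. A vertex of I gets the potential ρ; a vertex v of G ∖ I gets
-- min(ρ, 1 + ⌈own v / 2⌉) if v ∈ C and ρ − min(ρ, 1 + ⌊other v / 2⌋) otherwise, where own v
-- and other v are its distances to the sources of its own and of the opposite colour. By the
-- distance bound the potentials of the two ends of an edge of G ∖ I sum to at least ρ, so
-- thresholding splits them into ρ vertex covers D_k of G ∖ I, and
-- ρ (w(I) + w(OPT(G ∖ I))) ≤ Σ_k w(I ∪ D_k) = Σ_v potential(v) w_v. Along every edge of G the
-- potentials of the ends sum to at most the same sum for (ρ + 1)·1_C, and since w is the
-- degree vector of a nonnegative edge weighting y, Σ_v potential(v) w_v =
-- Σ_{uv} (potential u + potential v) y_uv ≤ (ρ + 1) w(C).

open import Defs hiding (sym)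
open import Data.Nat using (ℕ)
open import Data.Fin using (Fin)
open import Data.Bool using (Bool; true; false)
open import Relation.Nullary using (Dec)
open import Relation.Binary.PropositionalEquality using (_≡_; _≢_)

module NatLemmas where

  open import Data.Nat
  open import Data.Nat.Properties
  open import Data.Nat.Tactic.RingSolver using (solve-∀)
  open import Data.Fin using (zero; suc; toℕ)
  open import Data.Bool using (not; if_then_else_)
  open import Data.Bool.Properties using (not-involutive)
  open import Data.Product using (_×_; _,_)
  open import Relation.Nullary using (yes; no; does; contradiction)
  open import Relation.Binary.PropositionalEquality
  open ≤-Reasoning

  least : {P : ℕ → Set} → (∀ d → Dec (P d)) → ℕ → ℕ
  least P? zero    = zero
  least P? (suc c) with P? zero
  ... | yes _ = zero
  ... | no  _ = suc (least (λ d → P? (suc d)) c)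

  least-≤ : ∀ {P : ℕ → Set} (P? : ∀ d → Dec (P d)) c → least P? c ≤ c
  least-≤ P? zero    = z≤n
  least-≤ P? (suc c) with P? zero
  ... | yes _ = z≤n
  ... | no  _ = s≤s (least-≤ (λ d → P? (suc d)) c)

  least-holds : ∀ {P : ℕ → Set} (P? : ∀ d → Dec (P d)) c → least P? c < c → P (least P? c)
  least-holds P? (suc c) lt with P? zero
  ... | yes p = p
  ... | no  _ = least-holds (λ d → P? (suc d)) c (s<s⁻¹ lt)

  least-minimal : ∀ {P : ℕ → Set} (P? : ∀ d → Dec (P d)) c {d} → P d → least P? c ≤ d
  least-minimal P? zero    p = z≤n
  least-minimal P? (suc c) {zero} p with P? zero
  ... | yes _  = z≤n
  ... | no ¬p0 = contradiction p ¬p0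
  least-minimal P? (suc c) {suc d} p with P? zero
  ... | yes _ = z≤n
  ... | no  _ = s≤s (least-minimal (λ d → P? (suc d)) c p)

  count : ∀ {m} → (Fin m → Bool) → ℕ
  count {zero}  p = 0
  count {suc m} p = if p zero then suc (count (λ k → p (suc k))) else count (λ k → p (suc k))

  count-true : ∀ m → count {m} (λ _ → true) ≡ m
  count-true zero    = refl
  count-true (suc m) = cong suc (count-true m)

  count-< : ∀ m x → count {m} (λ k → does (toℕ k <? x)) ≡ m ⊓ x
  count-< zero    x       = refl
  count-< (suc m) zero    = trans (count-< m zero) (⊓-zeroʳ m)
  count-< (suc m) (suc x) = cong suc (count-< m x)

  count-≥ : ∀ m x → count {m} (λ k → does (x ≤? toℕ k)) ≡ m ∸ x
  count-≥ zero    x             = sym (0∸n≡0 x)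
  count-≥ (suc m) zero          = cong suc (count-≥ m zero)
  count-≥ (suc m) (suc zero)    = count-≥ m zero
  count-≥ (suc m) (suc (suc x)) = count-≥ m (suc x)

  isEven : ℕ → Bool
  isEven zero    = true
  isEven (suc n) = not (isEven n)

  Odd-2+ : ∀ {n} → Odd n → Odd (2 + n)
  Odd-2+ (k , refl) = suc k , cong suc (sym (*-suc 2 k))

  isEven-false⇒Odd : ∀ n → isEven n ≡ false → Odd n
  isEven-false⇒Odd (suc zero)    _ = 0 , refl
  isEven-false⇒Odd (suc (suc n)) e = Odd-2+ (isEven-false⇒Odd n (trans (sym (not-involutive _)) e))

  n≤⌈n/2⌉+⌈n/2⌉ : ∀ n → n ≤ ⌈ n /2⌉ + ⌈ n /2⌉
  n≤⌈n/2⌉+⌈n/2⌉ n = begin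
    n                  ≡⟨ ⌊n/2⌋+⌈n/2⌉≡n n ⟨
    ⌊ n /2⌋ + ⌈ n /2⌉  ≤⟨ +-monoˡ-≤ ⌈ n /2⌉ (⌊n/2⌋≤⌈n/2⌉ n) ⟩
    ⌈ n /2⌉ + ⌈ n /2⌉  ∎

  ⌈n/2⌉≤1+⌊n/2⌋ : ∀ n → ⌈ n /2⌉ ≤ suc ⌊ n /2⌋
  ⌈n/2⌉≤1+⌊n/2⌋ n = ⌊n/2⌋-mono (n≤1+n (suc n))

  ceil-halves-bound : ∀ ρ p q → 2 * ρ ≤ 4 + (p + q) → ρ ≤ suc ⌈ p /2⌉ + suc ⌈ q /2⌉
  ceil-halves-bound ρ p q h = *-cancelˡ-≤ 2 (begin
    2 * ρ                                            ≤⟨ h ⟩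
    4 + (p + q)                                      ≤⟨ +-monoʳ-≤ 4 (+-mono-≤ (n≤⌈n/2⌉+⌈n/2⌉ p) (n≤⌈n/2⌉+⌈n/2⌉ q)) ⟩
    4 + ((⌈ p /2⌉ + ⌈ p /2⌉) + (⌈ q /2⌉ + ⌈ q /2⌉))  ≡⟨ double ⌈ p /2⌉ ⌈ q /2⌉ ⟩
    2 * (suc ⌈ p /2⌉ + suc ⌈ q /2⌉)                  ∎)
    where
    double : ∀ a b → 4 + ((a + a) + (b + b)) ≡ 2 * (suc a + suc b)
    double = solve-∀

  floor-half-bound : ∀ ρ q → 2 * ρ ≤ 3 + q → ρ ≤ suc (suc ⌊ q /2⌋)
  floor-half-bound ρ q h = *-cancelˡ-≤ 2 (begin
    2 * ρ                        ≤⟨ h ⟩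
    3 + q                        ≡⟨ cong (3 +_) (⌊n/2⌋+⌈n/2⌉≡n q) ⟨
    3 + (⌊ q /2⌋ + ⌈ q /2⌉)      ≤⟨ +-monoʳ-≤ 3 (+-monoʳ-≤ ⌊ q /2⌋ (⌈n/2⌉≤1+⌊n/2⌋ q)) ⟩
    3 + (⌊ q /2⌋ + suc ⌊ q /2⌋)  ≡⟨ double ⌊ q /2⌋ ⟩
    2 * suc (suc ⌊ q /2⌋)        ∎)
    where
    double : ∀ a → 3 + (a + suc a) ≡ 2 * suc (suc a)
    double = solve-∀

  ⊓-sum : ∀ ρ {x y} → ρ ≤ x + y → ρ ≤ ρ ⊓ x + ρ ⊓ y
  ⊓-sum ρ {x} {y} ρ≤x+y with ρ ≤? x | ρ ≤? y
  ... | yes ρ≤x | _       rewrite m≤n⇒m⊓n≡m ρ≤x = m≤m+n ρ _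
  ... | no  _   | yes ρ≤y rewrite m≤n⇒m⊓n≡m ρ≤y = m≤n+m ρ _
  ... | no  ρ≰x | no  ρ≰y
    rewrite m≥n⇒m⊓n≡n (<⇒≤ (≰⇒> ρ≰x)) | m≥n⇒m⊓n≡n (<⇒≤ (≰⇒> ρ≰y)) = ρ≤x+y

  ≤1+⊓ : ∀ ρ {m} → ρ ≤ suc m → ρ ≤ suc (ρ ⊓ m)
  ≤1+⊓ ρ ρ≤1+m = ⊓-glb (n≤1+n ρ) ρ≤1+m

  ∸-sandwich : ∀ ρ {x y} → x ≤ ρ → x ≤ y → y ≤ suc x → ρ ≤ y + (ρ ∸ x) × y + (ρ ∸ x) ≤ suc ρ
  ∸-sandwich ρ {x} {y} x≤ρ x≤y y≤1+x =
    (begin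
      ρ            ≡⟨ m+[n∸m]≡n x≤ρ ⟨
      x + (ρ ∸ x)  ≤⟨ +-monoˡ-≤ (ρ ∸ x) x≤y ⟩
      y + (ρ ∸ x)  ∎) ,
    (begin
      y + (ρ ∸ x)        ≤⟨ +-monoˡ-≤ (ρ ∸ x) y≤1+x ⟩
      suc (x + (ρ ∸ x))  ≡⟨ cong suc (m+[n∸m]≡n x≤ρ) ⟩
      suc ρ              ∎)

-- dist v is the least d < cap with Near d v, and cap if there is none.
module BoundedDistance {m : ℕ} (E : Fin m → Fin m → Set) (E? : ∀ u v → Dec (E u v))
                       (S : Fin m → Set) (S? : ∀ v → Dec (S v)) (cap : ℕ) where

  open import Data.Nat
  open import Data.Nat.Properties
  open import Data.Fin.Properties using (any?)
  open import Data.Product using (∃; _×_; _,_)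
  open import Data.Sum using (_⊎_; inj₁; inj₂)
  open import Relation.Nullary using (yes; no; contradiction)
  open import Relation.Nullary.Decidable using (_⊎-dec_; _×-dec_)
  open import Relation.Binary.PropositionalEquality
  open NatLemmas using (least; least-≤; least-holds; least-minimal)

  Near : ℕ → Fin m → Set
  Near zero    v = S v
  Near (suc d) v = Near d v ⊎ ∃ λ u → E u v × Near d u

  near? : ∀ d v → Dec (Near d v)
  near? zero    v = S? v
  near? (suc d) v = near? d v ⊎-dec any? (λ u → E? u v ×-dec near? d u)

  dist : Fin m → ℕ
  dist v = least (λ d → near? d v) cap

  dist-≤-cap : ∀ v → dist v ≤ cap
  dist-≤-cap v = least-≤ (λ d → near? d v) cap

  dist-near : ∀ {v} → dist v < cap → Near (dist v) v
  dist-near {v} = least-holds (λ d → near? d v) cap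

  dist-minimal : ∀ {d v} → Near d v → dist v ≤ d
  dist-minimal {v = v} = least-minimal (λ d → near? d v) cap

  dist-source : ∀ {v} → S v → dist v ≡ 0
  dist-source s = n≤0⇒n≡0 (dist-minimal s)

  dist-step : ∀ {u v} → E u v → dist v ≤ suc (dist u)
  dist-step {u} {v} e with dist u <? cap
  ... | yes du<cap = dist-minimal (inj₂ (u , e , dist-near du<cap))
  ... | no  du≮cap = ≤-trans (dist-≤-cap v) (≤-trans (≮⇒≥ du≮cap) (n≤1+n (dist u)))

  dist-parent : ∀ {d v} → dist v ≡ suc d → suc d < cap → ∃ λ u → E u v × dist u ≡ d
  dist-parent {d} {v} dv≡1+d 1+d<cap
    with subst (λ t → Near t v) dv≡1+d (dist-near (subst (_< cap) (sym dv≡1+d) 1+d<cap))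
  ... | inj₁ near-d = contradiction (subst (_≤ d) dv≡1+d (dist-minimal near-d)) (n≮n d)
  ... | inj₂ (u , e , near-u) =
    u , e , ≤-antisym (dist-minimal near-u) (s≤s⁻¹ (subst (_≤ suc (dist u)) dv≡1+d (dist-step e)))

  record Descent (v : Fin m) (d : ℕ) : Set where
    field
      vertex      : ℕ → Fin m
      start       : vertex 0 ≡ v
      end         : S (vertex d)
      edge        : ∀ {j} → j < d → E (vertex (suc j)) (vertex j)
      dist-vertex : ∀ {j} → j ≤ d → dist (vertex j) + j ≡ d

  descent : ∀ d {v} → dist v ≡ d → d < cap → Descent v d
  descent zero {v} dv≡0 0<cap = record
    { vertex      = λ _ → v
    ; start       = refl
    ; end         = subst (λ t → Near t v) dv≡0 (dist-near (subst (_< cap) (sym dv≡0) 0<cap))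
    ; edge        = λ ()
    ; dist-vertex = λ { z≤n → trans (+-identityʳ (dist v)) dv≡0 }
    }
  descent (suc d) {v} dv≡1+d 1+d<cap with dist-parent dv≡1+d 1+d<cap
  ... | u , e , du≡d = record
    { vertex = vertex ; start = refl ; end = Descent.end rest ; edge = edge ; dist-vertex = dist-vertex }
    where
    rest : Descent u d
    rest = descent d du≡d (<-trans (n<1+n d) 1+d<cap)
    vertex : ℕ → Fin m
    vertex zero    = v
    vertex (suc j) = Descent.vertex rest j
    edge : ∀ {j} → j < suc d → E (vertex (suc j)) (vertex j)
    edge {zero}  _   = subst (λ t → E t v) (sym (Descent.start rest)) e
    edge {suc j} j<d = Descent.edge rest (s<s⁻¹ j<d)
    dist-vertex : ∀ {j} → j ≤ suc d → dist (vertex j) + j ≡ suc d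
    dist-vertex {zero}  _   = trans (+-identityʳ (dist v)) dv≡1+d
    dist-vertex {suc j} j≤d = trans (+-suc _ j) (cong suc (Descent.dist-vertex rest (s≤s⁻¹ j≤d)))

module Weights where

  open import Data.Nat as ℕ using (ℕ; NonZero; _∸_)
  import Data.Nat.Properties as ℕ
  open import Data.Integer as ℤ using (+_)
  import Data.Integer.Properties as ℤ
  open import Data.Fin using (zero; suc)
  open import Data.Bool using (if_then_else_; _∨_)
  open import Data.Rational using (ℚ; 0ℚ; 1ℚ; _≤_; _+_; _*_; _/_; toℚᵘ; nonNegative)
  import Data.Rational.Properties as ℚ
  import Data.Rational.Unnormalised as ℚᵘ
  import Data.Rational.Unnormalised.Properties as ℚᵘ
  open import Algebra.Bundles using (CommutativeRing)
  open import Algebra.Properties.Semiring.Sum (CommutativeRing.semiring ℚ.+-*-commutativeRing)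
    using (sum; sum-cong-≗; ∑-distrib-+; ∑-comm; *-distribˡ-sum)
  open import Relation.Nullary using (yes; no; contradiction)
  open import Relation.Binary.PropositionalEquality
  open NatLemmas using (count; count-true)

  fromℕ : ℕ → ℚ
  fromℕ n = + n / 1

  toℚᵘ-fromℕ : ∀ n → toℚᵘ (fromℕ n) ℚᵘ.≃ ℚᵘ.mkℚᵘ (+ n) 0
  toℚᵘ-fromℕ n = ℚ.toℚᵘ-fromℚᵘ (ℚᵘ.mkℚᵘ (+ n) 0)

  fromℕ-+ : ∀ m n → fromℕ (m ℕ.+ n) ≡ fromℕ m + fromℕ n
  fromℕ-+ m n = ℚ.toℚᵘ-injective (begin
    toℚᵘ (fromℕ (m ℕ.+ n))                ≈⟨ toℚᵘ-fromℕ (m ℕ.+ n) ⟩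
    ℚᵘ.mkℚᵘ (+ (m ℕ.+ n)) 0               ≈⟨ ℚᵘ.*≡* (trans (ℤ.*-identityʳ _) (trans (ℤ.pos-+ m n) (sym sum-num))) ⟩
    ℚᵘ.mkℚᵘ (+ m) 0 ℚᵘ.+ ℚᵘ.mkℚᵘ (+ n) 0  ≈⟨ ℚᵘ.+-cong (toℚᵘ-fromℕ m) (toℚᵘ-fromℕ n) ⟨
    toℚᵘ (fromℕ m) ℚᵘ.+ toℚᵘ (fromℕ n)    ≈⟨ ℚ.toℚᵘ-homo-+ (fromℕ m) (fromℕ n) ⟨
    toℚᵘ (fromℕ m + fromℕ n)              ∎)
    where
    open ℚᵘ.≃-Reasoning
    sum-num : (+ m ℤ.* + 1 ℤ.+ + n ℤ.* + 1) ℤ.* + 1 ≡ + m ℤ.+ + n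
    sum-num = trans (ℤ.*-identityʳ _) (cong₂ ℤ._+_ (ℤ.*-identityʳ (+ m)) (ℤ.*-identityʳ (+ n)))

  fromℕ-suc : ∀ n → fromℕ (ℕ.suc n) ≡ 1ℚ + fromℕ n
  fromℕ-suc = fromℕ-+ 1

  fromℕ-mono-≤ : ∀ {m n} → m ℕ.≤ n → fromℕ m ≤ fromℕ n
  fromℕ-mono-≤ {m} {n} m≤n = begin
    fromℕ m                  ≡⟨ ℚ.+-identityʳ (fromℕ m) ⟨
    fromℕ m + 0ℚ             ≤⟨ ℚ.+-monoʳ-≤ (fromℕ m) (ℚ.nonNegative⁻¹ _ {{ℚ.normalize-nonNeg (n ∸ m) 1}}) ⟩
    fromℕ m + fromℕ (n ∸ m)  ≡⟨ fromℕ-+ m (n ∸ m) ⟨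
    fromℕ (m ℕ.+ (n ∸ m))    ≡⟨ cong fromℕ (ℕ.m+[n∸m]≡n m≤n) ⟩
    fromℕ n                  ∎
    where open ℚ.≤-Reasoning

  fromℕ-inverse : ∀ r → fromℕ (ℕ.suc r) * ((+ 1) / ℕ.suc r) ≡ 1ℚ
  fromℕ-inverse r = ℚ.toℚᵘ-injective (begin
    toℚᵘ (fromℕ (ℕ.suc r) * ((+ 1) / ℕ.suc r))
      ≈⟨ ℚ.toℚᵘ-homo-* (fromℕ (ℕ.suc r)) ((+ 1) / ℕ.suc r) ⟩
    toℚᵘ (fromℕ (ℕ.suc r)) ℚᵘ.* toℚᵘ ((+ 1) / ℕ.suc r)
      ≈⟨ ℚᵘ.*-cong (toℚᵘ-fromℕ (ℕ.suc r)) (ℚ.toℚᵘ-fromℚᵘ (ℚᵘ.mkℚᵘ (+ 1) r)) ⟩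
    ℚᵘ.mkℚᵘ (+ ℕ.suc r) 0 ℚᵘ.* ℚᵘ.mkℚᵘ (+ 1) r
      ≈⟨ ℚᵘ.*≡* (trans (ℤ.*-identityʳ _) (trans (cong +_ (ℕ.*-comm (ℕ.suc r) 1)) (sym (ℤ.*-identityˡ _))))
       ⟩
    toℚᵘ 1ℚ ∎)
    where open ℚᵘ.≃-Reasoning

  rescale : ∀ ρ .{{_ : NonZero ρ}} {L W} → fromℕ ρ * L ≤ fromℕ (ℕ.suc ρ) * W → L ≤ (1ℚ + (+ 1) / ρ) * W
  rescale ρ@(ℕ.suc r) {L} {W} ρL≤[1+ρ]W =
    ℚ.*-cancelˡ-≤-pos (fromℕ ρ) {{ℚ.normalize-pos ρ 1}} (subst (fromℕ ρ * L ≤_) (sym expand) ρL≤[1+ρ]W)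
    where
    open ≡-Reasoning
    expand : fromℕ ρ * ((1ℚ + (+ 1) / ρ) * W) ≡ fromℕ (ℕ.suc ρ) * W
    expand = begin
      fromℕ ρ * ((1ℚ + (+ 1) / ρ) * W)
        ≡⟨ ℚ.*-assoc (fromℕ ρ) _ W ⟨
      fromℕ ρ * (1ℚ + (+ 1) / ρ) * W
        ≡⟨ cong (_* W) (ℚ.*-distribˡ-+ (fromℕ ρ) 1ℚ ((+ 1) / ρ)) ⟩
      (fromℕ ρ * 1ℚ + fromℕ ρ * ((+ 1) / ρ)) * W
        ≡⟨ cong (_* W) (cong₂ _+_ (ℚ.*-identityʳ (fromℕ ρ)) (fromℕ-inverse r)) ⟩
      (fromℕ ρ + 1ℚ) * W
        ≡⟨ cong (_* W) (trans (ℚ.+-comm (fromℕ ρ) 1ℚ) (sym (fromℕ-suc ρ))) ⟩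
      fromℕ (ℕ.suc ρ) * W
        ∎

  halve : ∀ {p q} → p + p ≤ q + q → p ≤ q
  halve {p} {q} 2p≤2q with p ℚ.≤? q
  ... | yes p≤q = p≤q
  ... | no  p≰q = contradiction (ℚ.<-≤-trans (ℚ.+-mono-< q<p q<p) 2p≤2q) (ℚ.<-irrefl refl)
    where
    q<p = ℚ.≰⇒> p≰q

  Σℚ≡sum : ∀ {m} (f : Fin m → ℚ) → Σℚ f ≡ sum f
  Σℚ≡sum {ℕ.zero}  f = refl
  Σℚ≡sum {ℕ.suc m} f = cong (λ s → f zero + s) (Σℚ≡sum (λ i → f (suc i)))

  sum-mono-≤ : ∀ {m} {f g : Fin m → ℚ} → (∀ i → f i ≤ g i) → sum f ≤ sum g
  sum-mono-≤ {ℕ.zero}  _   = ℚ.≤-refl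
  sum-mono-≤ {ℕ.suc m} f≤g = ℚ.+-mono-≤ (f≤g zero) (sum-mono-≤ (λ i → f≤g (suc i)))

  sum-indicator : ∀ {m} (p : Fin m → Bool) x → sum (λ k → if p k then x else 0ℚ) ≡ fromℕ (count p) * x
  sum-indicator {ℕ.zero}  p x = sym (ℚ.*-zeroˡ x)
  sum-indicator {ℕ.suc m} p x with p zero
  ... | true  = begin
    x + sum (λ k → if p (suc k) then x else 0ℚ)  ≡⟨ cong (λ s → x + s) (sum-indicator (λ k → p (suc k)) x) ⟩
    x + fromℕ c * x                              ≡⟨ cong (λ s → s + fromℕ c * x) (ℚ.*-identityˡ x) ⟨
    1ℚ * x + fromℕ c * x                         ≡⟨ ℚ.*-distribʳ-+ x 1ℚ (fromℕ c) ⟨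
    (1ℚ + fromℕ c) * x                           ≡⟨ cong (_* x) (fromℕ-suc c) ⟨
    fromℕ (ℕ.suc c) * x                          ∎
    where
    c = count (λ k → p (suc k))
    open ≡-Reasoning
  ... | false = trans (ℚ.+-identityˡ _) (sum-indicator (λ k → p (suc k)) x)

  sum-const : ∀ m x → sum {m} (λ _ → x) ≡ fromℕ m * x
  sum-const m x = trans (sum-indicator {m} (λ _ → true) x) (cong (λ c → fromℕ c * x) (count-true m))

  wt-∪ : ∀ {m} (w : Fin m → ℚ) {X Y : Fin m → Bool} → (∀ v → X v ≡ true → Y v ≡ false) →
         wt w X + wt w Y ≡ wt w (λ v → X v ∨ Y v)
  wt-∪ w {X} {Y} disjoint = begin
    wt w X + wt w Y            ≡⟨ cong₂ _+_ (Σℚ≡sum (χ X)) (Σℚ≡sum (χ Y)) ⟩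
    sum (χ X) + sum (χ Y)      ≡⟨ ∑-distrib-+ (χ X) (χ Y) ⟨
    sum (λ v → χ X v + χ Y v)  ≡⟨ sum-cong-≗ pointwise ⟩
    sum (χ (λ v → X v ∨ Y v))  ≡⟨ Σℚ≡sum (χ (λ v → X v ∨ Y v)) ⟨
    wt w (λ v → X v ∨ Y v)     ∎
    where
    open ≡-Reasoning
    χ : (Fin _ → Bool) → Fin _ → ℚ
    χ Z v = if Z v then w v else 0ℚ
    pointwise : ∀ v → χ X v + χ Y v ≡ χ (λ v → X v ∨ Y v) v
    pointwise v with X v in Xv
    ... | true rewrite disjoint v Xv = ℚ.+-identityʳ (w v)
    ... | false = ℚ.+-identityˡ (χ Y v)

  weighted : ∀ {m} → (Fin m → ℚ) → (Fin m → ℕ) → ℚ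
  weighted w a = sum (λ v → fromℕ (a v) * w v)

  sum-wt : ∀ {m k} (w : Fin m → ℚ) (X : Fin k → Fin m → Bool) →
           sum (λ j → wt w (X j)) ≡ weighted w (λ v → count (λ j → X j v))
  sum-wt w X = begin
    sum (λ j → wt w (X j))
      ≡⟨ sum-cong-≗ (λ j → Σℚ≡sum (λ v → if X j v then w v else 0ℚ)) ⟩
    sum (λ j → sum (λ v → if X j v then w v else 0ℚ))
      ≡⟨ ∑-comm (λ j v → if X j v then w v else 0ℚ) ⟩
    sum (λ v → sum (λ j → if X j v then w v else 0ℚ))
      ≡⟨ sum-cong-≗ (λ v → sum-indicator (λ j → X j v) (w v)) ⟩
    weighted w (λ v → count (λ j → X j v))
      ∎
    where open ≡-Reasoning

  weighted-scaled : ∀ {m} (w : Fin m → ℚ) (X : Fin m → Bool) c →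
                    weighted w (λ v → if X v then c else 0) ≡ fromℕ c * wt w X
  weighted-scaled w X c = begin
    weighted w (λ v → if X v then c else 0)  ≡⟨ sum-cong-≗ pointwise ⟩
    sum (λ v → fromℕ c * χ v)                ≡⟨ *-distribˡ-sum (fromℕ c) χ ⟨
    fromℕ c * sum χ                          ≡⟨ cong (fromℕ c *_) (Σℚ≡sum χ) ⟨
    fromℕ c * wt w X                         ∎
    where
    open ≡-Reasoning
    χ : Fin _ → ℚ
    χ v = if X v then w v else 0ℚ
    pointwise : ∀ v → fromℕ (if X v then c else 0) * w v ≡ fromℕ c * χ v
    pointwise v with X v
    ... | true  = refl
    ... | false = trans (ℚ.*-zeroˡ (w v)) (sym (ℚ.*-zeroʳ (fromℕ c)))

  module FractionalDegree (G : Graph) (w : Fin (n G) → ℚ) (y : Fin (n G) → Fin (n G) → ℚ)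
                          (y-nonneg : ∀ u v → 0ℚ ≤ y u v) (y-sym : ∀ u v → y u v ≡ y v u)
                          (y-edge : ∀ u v → adj G u v ≡ false → y u v ≡ 0ℚ) (y-w : ∀ v → Σℚ (y v) ≡ w v) where

    expand : ∀ a → weighted w a ≡ sum (λ v → sum (λ u → fromℕ (a v) * y v u))
    expand a = sum-cong-≗ λ v → begin
      fromℕ (a v) * w v                ≡⟨ cong (fromℕ (a v) *_) (trans (sym (y-w v)) (Σℚ≡sum (y v))) ⟩
      fromℕ (a v) * sum (y v)          ≡⟨ *-distribˡ-sum (fromℕ (a v)) (y v) ⟩
      sum (λ u → fromℕ (a v) * y v u)  ∎
      where open ≡-Reasoning

    expand-swapped : ∀ a → weighted w a ≡ sum (λ v → sum (λ u → fromℕ (a u) * y v u))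
    expand-swapped a = trans (expand a) (trans (∑-comm (λ v u → fromℕ (a v) * y v u))
      (sum-cong-≗ λ v → sum-cong-≗ λ u → cong (fromℕ (a u) *_) (y-sym u v)))

    doubled : ∀ a → weighted w a + weighted w a ≡ sum (λ v → sum (λ u → fromℕ (a v ℕ.+ a u) * y v u))
    doubled a = begin
      weighted w a + weighted w a
        ≡⟨ cong₂ _+_ (expand a) (expand-swapped a) ⟩
      sum (λ v → sum (λ u → out v u)) + sum (λ v → sum (λ u → into v u))
        ≡⟨ ∑-distrib-+ (λ v → sum (λ u → out v u)) (λ v → sum (λ u → into v u)) ⟨
      sum (λ v → sum (λ u → out v u) + sum (λ u → into v u))
        ≡⟨ sum-cong-≗ (λ v → ∑-distrib-+ (λ u → out v u) (λ u → into v u)) ⟨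
      sum (λ v → sum (λ u → out v u + into v u))
        ≡⟨ sum-cong-≗ (λ v → sum-cong-≗ λ u →
             trans (cong (_* y v u) (fromℕ-+ (a v) (a u))) (ℚ.*-distribʳ-+ (y v u) (fromℕ (a v)) (fromℕ (a u)))) ⟨
      sum (λ v → sum (λ u → fromℕ (a v ℕ.+ a u) * y v u))
        ∎
      where
      open ≡-Reasoning
      out into : Fin (n G) → Fin (n G) → ℚ
      out  v u = fromℕ (a v) * y v u
      into v u = fromℕ (a u) * y v u

    edge-dominated : ∀ (a b : Fin (n G) → ℕ) → (∀ {u v} → adj G u v ≡ true → a u ℕ.+ a v ℕ.≤ b u ℕ.+ b v) →
                     weighted w a ≤ weighted w b
    edge-dominated a b a≤b = halve (begin
      weighted w a + weighted w a                          ≡⟨ doubled a ⟩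
      sum (λ v → sum (λ u → fromℕ (a v ℕ.+ a u) * y v u))  ≤⟨ sum-mono-≤ (λ v → sum-mono-≤ (pointwise v)) ⟩
      sum (λ v → sum (λ u → fromℕ (b v ℕ.+ b u) * y v u))  ≡⟨ doubled b ⟨
      weighted w b + weighted w b                          ∎)
      where
      open ℚ.≤-Reasoning
      pointwise : ∀ v u → fromℕ (a v ℕ.+ a u) * y v u ≤ fromℕ (b v ℕ.+ b u) * y v u
      pointwise v u with adj G v u in vu
      ... | true  = ℚ.*-monoʳ-≤-nonNeg (y v u) {{nonNegative (y-nonneg v u)}} (fromℕ-mono-≤ (a≤b vu))
      ... | false rewrite y-edge v u vu =
        ℚ.≤-reflexive (trans (ℚ.*-zeroʳ (fromℕ (a v ℕ.+ a u))) (sym (ℚ.*-zeroʳ (fromℕ (b v ℕ.+ b u)))))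

module SplitGraph (G : Graph) (I : VSet G) (colour : Fin (n G) → Bool)
                  (proper : ∀ u v → I u ≡ false → I v ≡ false → adj G u v ≡ true → colour u ≢ colour v) where

  open import Data.Nat
  open import Data.Nat.Properties
  open import Data.Fin using (zero; suc; toℕ)
  open import Data.Fin.Properties using (any?; toℕ-injective; toℕ<n; toℕ-fromℕ<; toℕ≤pred[n])
  open import Data.Bool using (not; _∧_; _∨_; if_then_else_)
  open import Data.Bool.Properties using (¬-not; not-involutive) renaming (_≟_ to _≟ᵇ_)
  open import Data.Maybe using (Maybe; just; nothing)
  open import Data.Maybe.Properties using (just-injective)
  open import Data.List using (allFin)
  open import Data.List.Membership.Propositional.Properties using (∈-allFin)
  open import Data.List.Relation.Unary.All using (lookup)
  open import Data.List.Extrema.Nat using (argmin; f[argmin]≤f[xs])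
  open import Data.Product using (∃; _×_; _,_; proj₁; proj₂)
  open import Data.Sum using (_⊎_; inj₁; inj₂; swap)
  open import Data.Unit using (tt)
  open import Relation.Nullary using (yes; no; does; contradiction)
  open import Relation.Nullary.Decidable using (_×-dec_; dec-true)
  open import Relation.Binary.PropositionalEquality
  open NatLemmas

  V : Set
  V = Fin (n G)

  Edge∖I : V → V → Set
  Edge∖I u v = adj G u v ≡ true × I u ≡ false × I v ≡ false

  edge∖I? : ∀ u v → Dec (Edge∖I u v)
  edge∖I? u v = (adj G u v ≟ᵇ true) ×-dec (I u ≟ᵇ false) ×-dec (I v ≟ᵇ false)

  Edge∖I-sym : ∀ {u v} → Edge∖I u v → Edge∖I v u
  Edge∖I-sym {u} {v} (a , Iu , Iv) = trans (Graph.sym G v u) a , Iv , Iu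

  Edge∖I-colour : ∀ {u v} → Edge∖I u v → colour v ≡ not (colour u)
  Edge∖I-colour {u} {v} (a , Iu , Iv) = ¬-not (proper v u Iv Iu (trans (Graph.sym G v u) a))

  TouchesI : V → Set
  TouchesI v = ∃ λ i → I i ≡ true × adj G i v ≡ true

  touchesI? : ∀ v → Dec (TouchesI v)
  touchesI? v = any? (λ i → (I i ≟ᵇ true) ×-dec (adj G i v ≟ᵇ true))

  record Path (m : ℕ) : Set where
    field
      vertex    : ℕ → V
      edge      : ∀ {j} → j < m → Edge∖I (vertex j) (vertex (suc j))
      injective : ∀ {i j} → i ≤ m → j ≤ m → vertex i ≡ vertex j → i ≡ j

    colour-along : colour (vertex 0) ≡ true → ∀ {j} → j ≤ m → colour (vertex j) ≡ isEven j
    colour-along c₀ {zero}  _     = c₀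
    colour-along c₀ {suc j} 1+j≤m = trans (Edge∖I-colour (edge 1+j≤m)) (cong not (colour-along c₀ (<⇒≤ 1+j≤m)))

  next-toℕ : ∀ {k} (i : Fin (suc k)) → (toℕ i ≡ k × next i ≡ zero) ⊎ toℕ (next i) ≡ suc (toℕ i)
  next-toℕ {k} i with toℕ i ≟ k
  ... | yes i≡k = inj₁ (i≡k , refl)
  ... | no  i≢k = inj₂ (toℕ-fromℕ< (s≤s (≤∧≢⇒< (toℕ≤pred[n] i) i≢k)))

  -- Position 0 of the cycle is the contracted vertex v^I (nothing), position j + 1 is vertex j.
  path⇒cycle : ∀ {m} → 1 ≤ m → (P : Path m) → TouchesI (Path.vertex P 0) → TouchesI (Path.vertex P m) →
               CCycle G I (2 + m)
  path⇒cycle {suc m} _ P first last = m≤m+n 3 m , cycle , cycle-injective , cycle-vertex , cycle-adj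
    where
    open Path P

    walk : ℕ → Maybe V
    walk zero    = nothing
    walk (suc j) = just (vertex j)

    cycle : Fin (3 + m) → Maybe V
    cycle i = walk (toℕ i)

    outside-I : ∀ {j} → j ≤ suc m → I (vertex j) ≡ false
    outside-I j≤1+m with m≤n⇒m<n∨m≡n j≤1+m
    ... | inj₁ j<1+m = proj₁ (proj₂ (edge j<1+m))
    ... | inj₂ refl  = proj₂ (proj₂ (edge (n<1+n m)))

    walk-injective : ∀ {j k} → j < 3 + m → k < 3 + m → walk j ≡ walk k → j ≡ k
    walk-injective {zero}  {zero}  _     _     _ = refl
    walk-injective {suc j} {suc k} j<3+m k<3+m e =
      cong suc (injective (s≤s⁻¹ (s<s⁻¹ j<3+m)) (s≤s⁻¹ (s<s⁻¹ k<3+m)) (just-injective e))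

    cycle-injective : ∀ {i k} → cycle i ≡ cycle k → i ≡ k
    cycle-injective {i} {k} e = toℕ-injective (walk-injective (toℕ<n i) (toℕ<n k) e)

    walk-vertex : ∀ j → j < 3 + m → CVertex G I (walk j)
    walk-vertex zero    _     = tt
    walk-vertex (suc j) j<3+m = outside-I (s≤s⁻¹ (s<s⁻¹ j<3+m))

    cycle-vertex : ∀ i → CVertex G I (cycle i)
    cycle-vertex i = walk-vertex (toℕ i) (toℕ<n i)

    walk-adj : ∀ j → j ≤ suc m → CAdj G I (walk j) (walk (suc j))
    walk-adj zero    _     = first
    walk-adj (suc j) j<1+m = proj₁ (edge j<1+m)

    walk-closes : CAdj G I (walk (2 + m)) (walk 0)
    walk-closes = let i , Ii , a = last in i , Ii , trans (Graph.sym G _ i) a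

    cycle-adj : ∀ i → CAdj G I (cycle i) (cycle (next i))
    cycle-adj i with next-toℕ i
    ... | inj₁ (i≡2+m , next≡0) =
      subst₂ (λ j k → CAdj G I (walk j) (walk k)) (sym i≡2+m) (cong toℕ (sym next≡0)) walk-closes
    ... | inj₂ next≡1+i =
      subst (λ k → CAdj G I (walk (toℕ i)) (walk k)) (sym next≡1+i)
        (walk-adj (toℕ i) (s≤s⁻¹ (s<s⁻¹ (subst (_< 3 + m) next≡1+i (toℕ<n (next i))))))

  -- Colour true counts layers from below, colour false from above: an edge u v with
  -- g u + g v ≥ ρ meets every layer, and v lies in exactly g v of them.
  module Layers (ρ : ℕ) (g : V → ℕ) (g-≤ : ∀ v → g v ≤ ρ) (g-cover : ∀ {u v} → Edge∖I u v → ρ ≤ g u + g v) where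

    threshold : Fin ρ → V → Bool
    threshold k v = if colour v then does (toℕ k <? g v) else does (ρ ∸ g v ≤? toℕ k)

    layer : Fin ρ → VSet G
    layer k v = not (I v) ∧ threshold k v

    layer-∖I : ∀ {k v} → layer k v ≡ true → I v ≡ false
    layer-∖I {k} {v} e with I v
    ... | false = refl

    layer-I : ∀ {k v} → I v ≡ true → layer k v ≡ false
    layer-I Iv rewrite Iv = refl

    threshold-layer : ∀ {k v} → I v ≡ false → threshold k v ≡ true → layer k v ≡ true
    threshold-layer Iv e rewrite Iv = e

    threshold-below : ∀ {k v} → colour v ≡ true → toℕ k < g v → threshold k v ≡ true
    threshold-below {k} {v} c k<gv rewrite c = dec-true (toℕ k <? g v) k<gv

    threshold-above : ∀ {k v} → colour v ≡ false → ρ ∸ g v ≤ toℕ k → threshold k v ≡ true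
    threshold-above {k} {v} c ρ-gv≤k rewrite c = dec-true (ρ ∸ g v ≤? toℕ k) ρ-gv≤k

    layer-cover-from : ∀ k {u v} → Edge∖I u v → colour u ≡ true → layer k u ≡ true ⊎ layer k v ≡ true
    layer-cover-from k {u} {v} e@(_ , Iu , Iv) cu with toℕ k <? g u
    ... | yes k<gu = inj₁ (threshold-layer Iu (threshold-below cu k<gu))
    ... | no  k≮gu = inj₂ (threshold-layer Iv (threshold-above (trans (Edge∖I-colour e) (cong not cu)) ρ-gv≤k))
      where
      ρ-gv≤k : ρ ∸ g v ≤ toℕ k
      ρ-gv≤k = ≤-trans (m≤n+o⇒m∸n≤o ρ (g v) (subst (ρ ≤_) (+-comm (g u) (g v)) (g-cover e))) (≮⇒≥ k≮gu)

    layer-cover : ∀ k → VertexCoverMinus G I (layer k)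
    layer-cover k = (λ v → layer-∖I) , cover
      where
      cover : ∀ u v → I u ≡ false → I v ≡ false → adj G u v ≡ true → layer k u ≡ true ⊎ layer k v ≡ true
      cover u v Iu Iv a with colour u ≟ᵇ true
      ... | yes cu = layer-cover-from k (a , Iu , Iv) cu
      ... | no ¬cu = swap (layer-cover-from k (Edge∖I-sym (a , Iu , Iv))
                            (trans (Edge∖I-colour (a , Iu , Iv)) (cong not (¬-not ¬cu))))

    count-thresholds : ∀ v → count (λ k → threshold k v) ≡ g v
    count-thresholds v with colour v
    ... | true  = trans (count-< ρ (g v)) (m≥n⇒m⊓n≡n (g-≤ v))
    ... | false = trans (count-≥ ρ (ρ ∸ g v)) (m∸[m∸n]≡n (g-≤ v))

  module Distances (ρ : ℕ) (girth : ∀ k → Odd k → CCycle G I k → 2 * ρ ∸ 1 ≤ k) where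

    open ≤-Reasoning

    Source : Bool → V → Set
    Source b v = I v ≡ false × colour v ≡ b × TouchesI v

    source? : ∀ b v → Dec (Source b v)
    source? b v = (I v ≟ᵇ false) ×-dec (colour v ≟ᵇ b) ×-dec touchesI? v

    -- Capping at 2ρ is harmless: a vertex at the cap satisfies the height bound outright.
    module Dist (b : Bool) = BoundedDistance Edge∖I edge∖I? (Source b) (source? b) (2 * ρ)
    open Dist using (Descent; descent)

    dist : Bool → V → ℕ
    dist = Dist.dist

    height : V → ℕ
    height v = dist true v + dist false v

    module MinimalHeight (x : V) (minimal : ∀ y → height x ≤ height y)
                         (a<cap : dist true x < 2 * ρ) (b<cap : dist false x < 2 * ρ) where

      a b : ℕ
      a = dist true x
      b = dist false x

      A : Descent true x a
      A = descent true a refl a<cap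

      B : Descent false x b
      B = descent false b refl b<cap

      module A = Dist.Descent true A
      module B = Dist.Descent false B

      vertex : ℕ → V
      vertex j with j ≤? a
      ... | yes _ = A.vertex (a ∸ j)
      ... | no  _ = B.vertex (j ∸ a)

      vertex-≤ : ∀ {j} → j ≤ a → vertex j ≡ A.vertex (a ∸ j)
      vertex-≤ {j} j≤a with j ≤? a
      ... | yes _   = refl
      ... | no  j≰a = contradiction j≤a j≰a

      vertex-≥ : ∀ {j} → a ≤ j → vertex j ≡ B.vertex (j ∸ a)
      vertex-≥ {j} a≤j with j ≤? a
      ... | no  _   = refl
      ... | yes j≤a rewrite ≤-antisym j≤a a≤j | n∸n≡0 a = trans A.start (sym B.start)

      dist-left : ∀ {j} → j ≤ a → dist true (vertex j) ≡ j
      dist-left {j} j≤a = +-cancelʳ-≡ (a ∸ j) _ j (begin-equality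
        dist true (vertex j) + (a ∸ j)          ≡⟨ cong (λ v → dist true v + (a ∸ j)) (vertex-≤ j≤a) ⟩
        dist true (A.vertex (a ∸ j)) + (a ∸ j)  ≡⟨ A.dist-vertex (m∸n≤m a j) ⟩
        a                                       ≡⟨ m+[n∸m]≡n j≤a ⟨
        j + (a ∸ j)                             ∎)

      dist-right : ∀ {j} → a ≤ j → j ≤ a + b → dist false (vertex j) + (j ∸ a) ≡ b
      dist-right {j} a≤j j≤a+b rewrite vertex-≥ a≤j =
        B.dist-vertex (subst (j ∸ a ≤_) (m+n∸m≡n a b) (∸-monoˡ-≤ a j≤a+b))

      edge : ∀ {j} → j < a + b → Edge∖I (vertex j) (vertex (suc j))
      edge {j} j<a+b = edge-by-side (≤-<-connex (suc j) a)
        where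
        edge-by-side : suc j ≤ a ⊎ a < suc j → Edge∖I (vertex j) (vertex (suc j))
        edge-by-side (inj₁ 1+j≤a) = subst₂ Edge∖I
          (sym (trans (vertex-≤ (<⇒≤ 1+j≤a)) (cong A.vertex (+-∸-assoc 1 1+j≤a)))) (sym (vertex-≤ 1+j≤a))
          (A.edge (subst (_≤ a) (+-∸-assoc 1 1+j≤a) (m∸n≤m a j)))
        edge-by-side (inj₂ a<1+j) = subst₂ Edge∖I
          (sym (vertex-≥ a≤j)) (sym (trans (vertex-≥ (m≤n⇒m≤1+n a≤j)) (cong B.vertex (+-∸-assoc 1 a≤j))))
          (Edge∖I-sym (B.edge (subst (_≤ b) (+-∸-assoc 1 a≤j)
            (subst (suc j ∸ a ≤_) (m+n∸m≡n a b) (∸-monoˡ-≤ a j<a+b)))))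
          where
          a≤j : a ≤ j
          a≤j = s≤s⁻¹ a<1+j

      -- A crossing of the two descents from x would be a vertex of smaller height.
      no-crossing : ∀ {i j} → i ≤ a → a < j → j ≤ a + b → vertex i ≢ vertex j
      no-crossing {i} {j} i≤a a<j j≤a+b vi≡vj = <⇒≱ lower (minimal (vertex i))
        where
        dist-false< : dist false (vertex i) < b
        dist-false< = subst (dist false (vertex i) <_)
          (trans (cong (λ v → dist false v + (j ∸ a)) vi≡vj) (dist-right (<⇒≤ a<j) j≤a+b))
          (m<m+n _ (m<n⇒0<n∸m a<j))
        lower : height (vertex i) < height x
        lower = +-mono-≤-< (≤-trans (≤-reflexive (dist-left i≤a)) i≤a) dist-false<

      injective : ∀ {i j} → i ≤ a + b → j ≤ a + b → vertex i ≡ vertex j → i ≡ j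
      injective {i} {j} i≤a+b j≤a+b vi≡vj with ≤-<-connex i a | ≤-<-connex j a
      ... | inj₁ i≤a | inj₁ j≤a = trans (sym (dist-left i≤a)) (trans (cong (dist true) vi≡vj) (dist-left j≤a))
      ... | inj₁ i≤a | inj₂ a<j = contradiction vi≡vj (no-crossing i≤a a<j j≤a+b)
      ... | inj₂ a<i | inj₁ j≤a = contradiction (sym vi≡vj) (no-crossing j≤a a<i i≤a+b)
      ... | inj₂ a<i | inj₂ a<j =
        ∸-cancelʳ-≡ (<⇒≤ a<i) (<⇒≤ a<j) (+-cancelˡ-≡ (dist false (vertex i)) _ _ (begin-equality
        dist false (vertex i) + (i ∸ a)  ≡⟨ dist-right (<⇒≤ a<i) i≤a+b ⟩
        b                                ≡⟨ dist-right (<⇒≤ a<j) j≤a+b ⟨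
        dist false (vertex j) + (j ∸ a)  ≡⟨ cong (λ v → dist false v + (j ∸ a)) vi≡vj ⟨
        dist false (vertex i) + (j ∸ a)  ∎))

      path : Path (a + b)
      path = record { vertex = vertex ; edge = edge ; injective = injective }

      first-source : Source true (vertex 0)
      first-source = subst (Source true) (sym (vertex-≤ z≤n)) A.end

      last-source : Source false (vertex (a + b))
      last-source =
        subst (Source false) (sym (trans (vertex-≥ (m≤m+n a b)) (cong B.vertex (m+n∸m≡n a b)))) B.end

      odd : Odd (a + b)
      odd = isEven-false⇒Odd (a + b)
        (trans (sym (Path.colour-along path (proj₁ (proj₂ first-source)) ≤-refl)) (proj₁ (proj₂ last-source)))

      girth-bound : 2 * ρ ≤ 3 + height x
      girth-bound = ≤-trans (m≤n+m∸n (2 * ρ) 1) (s≤s (girth (2 + (a + b)) (Odd-2+ odd)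
        (path⇒cycle (odd⇒1≤ odd) path (proj₂ (proj₂ first-source)) (proj₂ (proj₂ last-source)))))
        where
        odd⇒1≤ : ∀ {k} → Odd k → 1 ≤ k
        odd⇒1≤ (_ , refl) = s≤s z≤n

    minimal-height-bound : ∀ x → (∀ y → height x ≤ height y) → 2 * ρ ≤ 3 + height x
    minimal-height-bound x minimal with dist true x <? 2 * ρ | dist false x <? 2 * ρ
    ... | yes a<cap | yes b<cap = MinimalHeight.girth-bound x minimal a<cap b<cap
    ... | no  a≮cap | _         =
      ≤-trans (≮⇒≥ a≮cap) (≤-trans (m≤m+n (dist true x) (dist false x)) (m≤n+m (height x) 3))
    ... | _         | no  b≮cap =
      ≤-trans (≮⇒≥ b≮cap) (≤-trans (m≤n+m (dist false x) (dist true x)) (m≤n+m (height x) 3))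

    height-bound : ∀ v → 2 * ρ ≤ 3 + height v
    height-bound v = ≤-trans (minimal-height-bound x₀ x₀-minimal) (+-monoʳ-≤ 3 (x₀-minimal v))
      where
      x₀ : V
      x₀ = argmin height v (allFin _)
      x₀-minimal : ∀ y → height x₀ ≤ height y
      x₀-minimal y = lookup (f[argmin]≤f[xs] v (allFin _)) (∈-allFin y)

    module Potentials (independent : Independent G I) (C : VSet G) (C-cover : VertexCover G C) where

      own other : V → ℕ
      own   v = dist (colour v) v
      other v = dist (not (colour v)) v

      own+other-bound : ∀ v → 2 * ρ ≤ 3 + (own v + other v)
      own+other-bound v with colour v
      ... | true  = height-bound v
      ... | false = subst (λ h → 2 * ρ ≤ 3 + h) (+-comm (dist true v) (dist false v)) (height-bound v)

      own-across : ∀ {u v} → Edge∖I u v → own v ≡ dist (not (colour u)) v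
      own-across {u} {v} e = cong (λ c → dist c v) (Edge∖I-colour e)

      other-across : ∀ {u v} → Edge∖I u v → other v ≡ dist (colour u) v
      other-across {u} {v} e =
        trans (cong (λ c → dist (not c) v) (Edge∖I-colour e)) (cong (λ c → dist c v) (not-involutive (colour u)))

      own-touching : ∀ {v} → I v ≡ false → TouchesI v → own v ≡ 0
      own-touching {v} Iv t = Dist.dist-source (colour v) (Iv , refl , t)

      inner outer : V → ℕ
      inner v = ρ ⊓ suc ⌈ own v /2⌉
      outer v = ρ ∸ ρ ⊓ suc ⌊ other v /2⌋

      inner-touching : ∀ {v} → I v ≡ false → TouchesI v → inner v ≤ 1
      inner-touching {v} Iv t rewrite own-touching Iv t = m⊓n≤n ρ 1

      outer-touching : ∀ {v} → I v ≡ false → TouchesI v → outer v ≤ 1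
      outer-touching {v} Iv t =
        m≤n+o⇒m∸n≤o ρ _ (subst (ρ ≤_) (+-comm 1 _) (≤1+⊓ ρ (floor-half-bound ρ (other v) near-bound)))
        where
        near-bound : 2 * ρ ≤ 3 + other v
        near-bound = subst (λ o → 2 * ρ ≤ 3 + (o + other v)) (own-touching Iv t) (own+other-bound v)

      inner-edge : ∀ {u v} → Edge∖I u v → ρ ≤ inner u + inner v
      inner-edge {u} {v} e rewrite own-across e =
        ⊓-sum ρ (ceil-halves-bound ρ (own u) (dist (not (colour u)) v) (begin
        2 * ρ                                        ≤⟨ own+other-bound u ⟩
        3 + (own u + other u)                        ≤⟨ +-monoʳ-≤ 3 (+-monoʳ-≤ (own u)
                                                          (Dist.dist-step (not (colour u)) (Edge∖I-sym e))) ⟩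
        3 + (own u + suc (dist (not (colour u)) v))  ≡⟨ cong (3 +_) (+-suc (own u) _) ⟩
        4 + (own u + dist (not (colour u)) v)        ∎))

      -- dist (colour u) changes by at most one along the edge, so ⌊ _ /2⌋ at v and ⌈ _ /2⌉ at u
      -- differ by at most one.
      mixed-edge : ∀ {u v} → Edge∖I u v → ρ ≤ inner u + outer v × inner u + outer v ≤ suc ρ
      mixed-edge {u} {v} e rewrite other-across e =
        ∸-sandwich ρ (m⊓n≤m ρ _)
          (⊓-monoʳ-≤ ρ (s≤s (⌊n/2⌋-mono (Dist.dist-step (colour u) e))))
          (⊓-mono-≤ (n≤1+n ρ) (s≤s (⌊n/2⌋-mono (s≤s (Dist.dist-step (colour u) (Edge∖I-sym e))))))

      potential∖I : V → ℕ
      potential∖I v = if C v then inner v else outer v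

      potential∖I-≤ : ∀ v → potential∖I v ≤ ρ
      potential∖I-≤ v with C v
      ... | true  = m⊓n≤m ρ _
      ... | false = m∸n≤m ρ (ρ ⊓ suc ⌊ other v /2⌋)

      potential∖I-touching : ∀ {v} → I v ≡ false → TouchesI v → potential∖I v ≤ 1
      potential∖I-touching {v} Iv t with C v
      ... | true  = inner-touching Iv t
      ... | false = outer-touching Iv t

      potential∖I-cover : ∀ {u v} → Edge∖I u v → ρ ≤ potential∖I u + potential∖I v
      potential∖I-cover {u} {v} e@(a , _) with C u | C v | C-cover u v a
      ... | true  | true  | _ = inner-edge e
      ... | true  | false | _ = proj₁ (mixed-edge e)
      ... | false | true  | _ = subst (ρ ≤_) (+-comm (inner v) (outer u)) (proj₁ (mixed-edge (Edge∖I-sym e)))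
      ... | false | false | inj₁ ()
      ... | false | false | inj₂ ()

      potential∖I-mixed : ∀ {u v} → Edge∖I u v → C u ≡ false ⊎ C v ≡ false →
                          potential∖I u + potential∖I v ≤ suc ρ
      potential∖I-mixed {u} {v} e@(a , _) one-outside with C u | C v | C-cover u v a
      ... | true  | true  | _ = contradiction one-outside λ { (inj₁ ()) ; (inj₂ ()) }
      ... | true  | false | _ = proj₂ (mixed-edge e)
      ... | false | true  | _ =
        subst (_≤ suc ρ) (+-comm (inner v) (outer u)) (proj₂ (mixed-edge (Edge∖I-sym e)))
      ... | false | false | inj₁ ()
      ... | false | false | inj₂ ()

      potential : V → ℕ
      potential v = if I v then ρ else potential∖I v

      potential-≤ : ∀ v → potential v ≤ ρ
      potential-≤ v with I v
      ... | true  = ≤-refl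
      ... | false = potential∖I-≤ v

      cost : V → ℕ
      cost v = if C v then suc ρ else 0

      ρ<cost : ∀ {v} → C v ≡ true → ρ < cost v
      ρ<cost Cv rewrite Cv = ≤-refl

      cost-edge : ∀ {u v} → adj G u v ≡ true → suc ρ ≤ cost u + cost v
      cost-edge {u} {v} a with C u | C v | C-cover u v a
      ... | true  | _     | _ = m≤m+n (suc ρ) _
      ... | false | true  | _ = ≤-refl
      ... | false | false | inj₁ ()
      ... | false | false | inj₂ ()

      potential-mixed : ∀ {u v} → adj G u v ≡ true → C u ≡ false ⊎ C v ≡ false →
                        potential u + potential v ≤ suc ρ
      potential-mixed {u} {v} a one-outside with I u in Iu | I v in Iv
      ... | true  | true  = contradiction (trans (sym a) (independent u v Iu Iv)) λ ()
      ... | true  | false =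
        subst (ρ + potential∖I v ≤_) (+-comm ρ 1) (+-monoʳ-≤ ρ (potential∖I-touching Iv (u , Iu , a)))
      ... | false | true  = +-monoˡ-≤ ρ (potential∖I-touching Iu (v , Iv , trans (Graph.sym G v u) a))
      ... | false | false = potential∖I-mixed (a , Iu , Iv) one-outside

      potential-edge : ∀ {u v} → adj G u v ≡ true → potential u + potential v ≤ cost u + cost v
      potential-edge {u} {v} a with C u ≟ᵇ true | C v ≟ᵇ true
      ... | yes Cu | yes Cv =
        +-mono-≤ (≤-trans (potential-≤ u) (<⇒≤ (ρ<cost Cu))) (≤-trans (potential-≤ v) (<⇒≤ (ρ<cost Cv)))
      ... | no  Cu | _      = ≤-trans (potential-mixed a (inj₁ (¬-not Cu))) (cost-edge a)
      ... | _      | no  Cv = ≤-trans (potential-mixed a (inj₂ (¬-not Cv))) (cost-edge a)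

      open Layers ρ potential∖I potential∖I-≤ potential∖I-cover public

      count-I∪layers : ∀ v → count (λ k → I v ∨ layer k v) ≡ potential v
      count-I∪layers v with I v
      ... | true  = count-true ρ
      ... | false = count-thresholds v

open import Data.Nat using (ℕ; NonZero; _∸_) renaming (_*_ to _*ℕ_)
open import Data.Integer using (+_)
open import Data.Rational using (ℚ; _≤_; _+_; _*_; _/_; 1ℚ)
open import Relation.Nullary using (¬_)
open import Relation.Binary.PropositionalEquality using (_≡_)
import Data.Nat as ℕ
import Data.Rational.Properties as ℚ
open import Data.Bool using (_∨_)
open import Data.Product using (_,_)
open import Relation.Binary.PropositionalEquality using (cong)
open import Algebra.Bundles using (CommutativeRing)
open import Algebra.Properties.Semiring.Sum (CommutativeRing.semiring ℚ.+-*-commutativeRing) using (sum; sum-cong-≗)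
open NatLemmas using (count)
open Weights

mainTheorem9 : (G : Graph) → ¬ Bipartite G → (I : VSet G) → Independent G I →
    BipartiteMinus G I → (ρ : ℕ) → .{{_ : NonZero ρ}} → OddGirthContr G I (2 *ℕ ρ ∸ 1) →
    (w : Fin' G → ℚ) → InQW G w →
    (C₁ : VSet G) → IsOPTMinus G I w C₁ → (C₂ : VSet G) → IsOPT G w C₂ →
    wt w I + wt w C₁ ≤ (1ℚ + (+ 1) / ρ) * wt w C₂
mainTheorem9 G _ I independent (colour , proper) ρ (_ , girth) w (_ , _ , y , y-nonneg , y-sym , y-edge , y-w)
             C₁ (_ , C₁-minimal) C₂ (C₂-cover , _) = rescale ρ (begin
  fromℕ ρ * (wt w I + wt w C₁)
    ≡⟨ sum-const ρ (wt w I + wt w C₁) ⟨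
  sum (λ (_ : Fin ρ) → wt w I + wt w C₁)
    ≤⟨ sum-mono-≤ (λ k → ℚ.+-monoʳ-≤ (wt w I) (C₁-minimal (layer k) (layer-cover k))) ⟩
  sum (λ k → wt w I + wt w (layer k))
    ≡⟨ sum-cong-≗ (λ k → wt-∪ w {I} {layer k} (λ v → layer-I)) ⟩
  sum (λ k → wt w (λ v → I v ∨ layer k v))
    ≡⟨ sum-wt w (λ k v → I v ∨ layer k v) ⟩
  weighted w (λ v → count (λ k → I v ∨ layer k v))
    ≡⟨ sum-cong-≗ (λ v → cong (λ c → fromℕ c * w v) (count-I∪layers v)) ⟩
  weighted w potential
    ≤⟨ edge-dominated potential cost potential-edge ⟩
  weighted w cost
    ≡⟨ weighted-scaled w C₂ (ℕ.suc ρ) ⟩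
  fromℕ (ℕ.suc ρ) * wt w C₂
    ∎)
  where
  open SplitGraph.Distances.Potentials G I colour proper ρ girth independent C₂ C₂-cover
  open FractionalDegree G w y y-nonneg y-sym y-edge y-w
  open ℚ.≤-Reasoning
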